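{- Let $k\geq 1$ and let $\mathcal{G}$ be a class of graphs such that every $G\in\mathcal{G}$ satisfies $\Delta(G)\leq\delta(G)^k$. Then there exists a constant $c_{\mathcal{G},k}$ such that for every $G\in\mathcal{G}$ on $n$ vertices with minimum degree $\delta$, \[\overset{\rightarrow}{\gamma}_{LD}(G)\leq c_{\mathcal{G},k}\cdot\frac{\log\delta}{\delta}\cdot n.\]
   Context: All graphs are finite and simple; $\Delta(G)$ and $\delta(G)$ denote maximum and minimum degree; logarithms are base 2. For an orientation $D$ of $G=(V,E)$ (each edge given exactly one direction), a set $S\subseteq V$ is locating-dominating in $D$ if every $u\notin S$ has an in-neighbour in $S$ and distinct $u,v\notin S$ have distinct sets of in-neighbours in $S$; $\gamma_{LD}(D)$ is the minimum size of such a set. $\overset{\rightarrow}{\gamma}_{LD}(G)$ is the minimum of $\gamma_{LD}(D)$ over all orientations $D$ of $G$. -}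

module Defs where

open import Data.Nat using (ℕ; zero; suc; _⊔_; _⊓_)
open import Data.Bool using (Bool; true; false; not; _∧_)
open import Data.Fin using (Fin; zero)
open import Data.Fin.Subset using (Subset; ∣_∣)
open import Data.Vec using (tabulate; lookup)
open import Data.List using (foldr; map; allFin)
open import Relation.Binary.PropositionalEquality using (_≡_; _≢_)
open import Data.Product using (_×_)

record Graph (n : ℕ) : Set where
  field
    adj    : Fin n → Fin n → Bool
    sym    : ∀ u v → adj u v ≡ adj v u
    irrefl : ∀ u → adj u u ≡ false
open Graph public

deg : ∀ {n} → Graph n → Fin n → ℕ
deg G v = ∣ tabulate (adj G v) ∣

maxDeg : ∀ {n} → Graph n → ℕ
maxDeg {n} G = foldr _⊔_ 0 (map (deg G) (allFin n))

-- Minimum degree δ(G) (convention: 0 for the empty graph).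
minDeg : ∀ {n} → Graph n → ℕ
minDeg {zero}  G = 0
minDeg {suc m} G = foldr _⊓_ (deg G zero) (map (deg G) (allFin (suc m)))

-- An orientation of G: dir u v ≡ true means the edge uv is directed u → v.
-- Every edge gets exactly one direction, non-edges get none.
record Orientation {n : ℕ} (G : Graph n) : Set where
  field
    dir      : Fin n → Fin n → Bool
    onEdges  : ∀ u v → dir u v ≡ true → adj G u v ≡ true
    oneWay   : ∀ u v → adj G u v ≡ true → dir u v ≡ not (dir v u)
open Orientation public

inNbrsIn : ∀ {n} {G : Graph n} → Orientation G → Subset n → Fin n → Subset n
inNbrsIn D S u = tabulate (λ w → lookup S w ∧ dir D w u)

IsLocDom : ∀ {n} {G : Graph n} → Orientation G → Subset n → Set
IsLocDom {n} D S =
  (∀ u → lookup S u ≡ false → ∣ inNbrsIn D S u ∣ ≢ 0) ×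
  (∀ u v → u ≢ v → lookup S u ≡ false → lookup S v ≡ false →
     inNbrsIn D S u ≢ inNbrsIn D S v)

-- Write δ for the minimum degree, Δ for the maximum degree, 2 ^ ℓ ≤ δ < 2 ^ (ℓ + 1), and take
-- m = 2 + 2 (ℓ + 1) k, so that Δ ≤ δ ^ k gives Δ² + 1 < 2 ^ m.
--
-- First a set S in which every other vertex has at least m neighbours is built greedily. With the
-- potential Φ(S) = ∑_{u ∉ S} (2 ^ max(0, m - |N(u) ∩ S|) - 1), adding w to S at least halves the
-- term of every neighbour of w outside S. A vertex with fewer than m neighbours in S has at least
-- δ / 2 neighbours outside S, so by averaging some w lowers Φ by the factor 1 - δ / 4n. After
-- O((m + ℓ) n / δ) steps Φ ≤ n / δ, and the at most Φ vertices still lacking m neighbours in S are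
-- added, so that |S| δ = O(n (m + ℓ)) = O(k n log δ).
--
-- Next each u ∉ S receives a nonempty set I(u) of neighbours of u in S, different from the labels
-- of all vertices sharing a neighbour with u: there are at most Δ² of them, and 2 ^ m - 1 > Δ²
-- candidates. An edge between w ∈ S and u ∉ S is directed towards u exactly when w ∈ I(u), so
-- that the in-neighbourhood of u in S is I(u). Equal nonempty labels would force a common
-- neighbour, hence S is locating-dominating.

module Submission where

open import Defs hiding (sym)
open import Data.Nat hiding (_≟_)
open import Data.Nat.Properties hiding (_≟_)
open import Data.Nat.GeneralisedArithmetic using (fold)
open import Data.Nat.DivMod using (_/_; _%_; m≡m%n+[m/n]*n; m%n<n; m/n*n≤m)
open import Data.Bool using (Bool; true; false; not; _∧_; _∨_; if_then_else_)
open import Data.Bool.Properties using (∧-conicalˡ; ∧-conicalʳ; ∧-zeroʳ; ∧-identityʳ; not-involutive)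
open import Data.Fin using (Fin; zero; suc; _≟_)
open import Data.Fin.Subset as Subset using (Subset; ∣_∣; inside; outside; _⊆_; _∈_; ⊥; Nonempty)
open import Data.Fin.Subset.Properties
  using (⊆-refl; out⊆; in⊆in; ∉⊥; nonempty?; Empty-unique; x∈p⇒∣p-x∣<∣p∣)
open import Data.Vec using ([]; _∷_; head; tail; lookup; tabulate)
open import Data.Vec.Properties using (lookup∘tabulate; tabulate∘lookup; tabulate-cong; []=⇒lookup; lookup⇒[]=)
open import Data.Vec.Functional as Vector using (updateAt)
open import Data.Vec.Functional.Properties using (updateAt-updates; updateAt-minimal)
open import Data.List using (List; []; _∷_; foldr; allFin)
open import Data.List.Membership.Propositional using () renaming (_∈_ to _∈ₗ_)
open import Data.List.Membership.Propositional.Properties using (∈-allFin; ∈-map⁺)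
open import Data.List.Relation.Unary.Any using (here; there)
open import Data.Product using (∃-syntax; _×_; _,_; proj₁; proj₂)
open import Data.Sum using (_⊎_; inj₁; inj₂)
open import Data.Empty using (⊥-elim)
open import Data.Nat.Tactic.RingSolver using (solve-∀)
open import Relation.Nullary using (does; yes; no; ofʸ; ofⁿ)
open import Relation.Binary.PropositionalEquality
open import Algebra.Properties.Semiring.Sum +-*-semiring
  using (sum; sum-syntax; ∑-distrib-+; ∑-comm; *-distribˡ-sum; sum-cong-≗; sum-replicate-zero)

𝟙 : Bool → ℕ
𝟙 true  = 1
𝟙 false = 0

𝟙≤1 : ∀ b → 𝟙 b ≤ 1
𝟙≤1 true  = ≤-refl
𝟙≤1 false = z≤n

𝟙-∧ : ∀ a b → 𝟙 (a ∧ b) ≡ 𝟙 a * 𝟙 b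
𝟙-∧ true  b = sym (+-identityʳ (𝟙 b))
𝟙-∧ false b = refl

𝟙[0<ᵇ]≤ : ∀ c → 𝟙 (0 <ᵇ c) ≤ c
𝟙[0<ᵇ]≤ zero    = z≤n
𝟙[0<ᵇ]≤ (suc c) = s≤s z≤n

count : ∀ {n} → (Fin n → Bool) → ℕ
count p = ∑[ i < _ ] 𝟙 (p i)

∣tabulate∣≡count : ∀ {n} (p : Fin n → Bool) → ∣ tabulate p ∣ ≡ count p
∣tabulate∣≡count {zero}  p = refl
∣tabulate∣≡count {suc n} p with p zero
... | true  = cong suc (∣tabulate∣≡count (λ i → p (suc i)))
... | false = ∣tabulate∣≡count (λ i → p (suc i))

sum-mono-≤ : ∀ {n} {f g : Fin n → ℕ} → (∀ i → f i ≤ g i) → sum f ≤ sum g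
sum-mono-≤ {zero}  f≤g = z≤n
sum-mono-≤ {suc n} f≤g = +-mono-≤ (f≤g zero) (sum-mono-≤ (λ i → f≤g (suc i)))

sum-≤-* : ∀ {n} c (f : Fin n → ℕ) → (∀ i → f i ≤ c) → sum f ≤ n * c
sum-≤-* {zero}  c f f≤c = z≤n
sum-≤-* {suc n} c f f≤c = +-mono-≤ (f≤c zero) (sum-≤-* c (λ i → f (suc i)) (λ i → f≤c (suc i)))

sum-≤-*-argmax : ∀ {n} (f : Fin (suc n) → ℕ) → ∃[ i ] (sum f ≤ suc n * f i)
sum-≤-*-argmax {zero}  f = zero , ≤-refl
sum-≤-*-argmax {suc n} f with sum-≤-*-argmax (λ i → f (suc i))
... | i , ≤fi with f zero ≤? f (suc i)
...   | yes f₀≤fi = suc i , +-mono-≤ f₀≤fi ≤fi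
...   | no  f₀≰fi = zero , +-monoʳ-≤ (f zero) (≤-trans ≤fi (*-monoʳ-≤ (suc n) (<⇒≤ (≰⇒> f₀≰fi))))

sum-select : ∀ {n} (w : Fin n) (f : Fin n → ℕ) → ∑[ v < n ] (𝟙 (does (v ≟ w)) * f v) ≡ f w
sum-select {suc n} zero    f = begin
  1 * f zero + sum {n} (λ _ → 0) ≡⟨ cong (1 * f zero +_) (sum-replicate-zero n) ⟩
  1 * f zero + 0                 ≡⟨ +-identityʳ _ ⟩
  1 * f zero                     ≡⟨ *-identityˡ (f zero) ⟩
  f zero                         ∎
  where open ≡-Reasoning
sum-select {suc n} (suc w) f = sum-select w (λ v → f (suc v))

count-≤ : ∀ {n} (p : Fin n → Bool) → count p ≤ n
count-≤ {n} p = ≤-trans (sum-≤-* 1 (λ i → 𝟙 (p i)) (λ i → 𝟙≤1 (p i))) (≤-reflexive (*-identityʳ n))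

count-pos : ∀ {n} (p : Fin n → Bool) i → p i ≡ true → 0 < count p
count-pos p zero    pi≡true rewrite pi≡true = s≤s z≤n
count-pos p (suc i) pi≡true = ≤-trans (count-pos (λ j → p (suc j)) i pi≡true) (m≤n+m _ (𝟙 (p zero)))

count-∨ : ∀ {n} (p q : Fin n → Bool) → count (λ i → p i ∨ q i) ≤ count p + count (λ i → not (p i) ∧ q i)
count-∨ p q = begin
  count (λ i → p i ∨ q i)                         ≤⟨ sum-mono-≤ (λ i → 𝟙-∨ (p i) (q i)) ⟩
  ∑[ i < _ ] (𝟙 (p i) + 𝟙 (not (p i) ∧ q i))     ≡⟨ ∑-distrib-+ (λ i → 𝟙 (p i)) (λ i → 𝟙 (not (p i) ∧ q i)) ⟩
  count p + count (λ i → not (p i) ∧ q i)         ∎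
  where
  open ≤-Reasoning
  𝟙-∨ : ∀ a b → 𝟙 (a ∨ b) ≤ 𝟙 a + 𝟙 (not a ∧ b)
  𝟙-∨ true  b = ≤-refl
  𝟙-∨ false b = ≤-refl

count-split : ∀ {n} (p q : Fin n → Bool) → count (λ i → p i ∧ q i) + count (λ i → p i ∧ not (q i)) ≡ count p
count-split p q = trans (sym (∑-distrib-+ (λ i → 𝟙 (p i ∧ q i)) (λ i → 𝟙 (p i ∧ not (q i)))))
                        (sum-cong-≗ (λ i → 𝟙-split (p i) (q i)))
  where
  𝟙-split : ∀ a b → 𝟙 (a ∧ b) + 𝟙 (a ∧ not b) ≡ 𝟙 a
  𝟙-split true  true  = refl
  𝟙-split true  false = refl
  𝟙-split false b     = refl

deg≡count : ∀ {n} (G : Graph n) v → deg G v ≡ count (adj G v)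
deg≡count G v = ∣tabulate∣≡count (adj G v)

minDeg≤deg : ∀ {n} (G : Graph n) v → minDeg G ≤ count (adj G v)
minDeg≤deg {suc n} G v = begin
  minDeg G     ≤⟨ foldr-⊓-≤ (deg G zero) (∈-map⁺ (deg G) (∈-allFin v)) ⟩
  deg G v      ≡⟨ deg≡count G v ⟩
  count (adj G v) ∎
  where
  open ≤-Reasoning
  foldr-⊓-≤ : ∀ a {xs : List ℕ} {x} → x ∈ₗ xs → foldr _⊓_ a xs ≤ x
  foldr-⊓-≤ a (here refl) = m⊓n≤m _ _
  foldr-⊓-≤ a (there x∈xs) = ≤-trans (m⊓n≤n _ _) (foldr-⊓-≤ a x∈xs)

deg≤maxDeg : ∀ {n} (G : Graph n) v → count (adj G v) ≤ maxDeg G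
deg≤maxDeg {n} G v = begin
  count (adj G v) ≡⟨ deg≡count G v ⟨
  deg G v         ≤⟨ ≤-foldr-⊔ 0 (∈-map⁺ (deg G) (∈-allFin v)) ⟩
  maxDeg G        ∎
  where
  open ≤-Reasoning
  ≤-foldr-⊔ : ∀ a {xs : List ℕ} {x} → x ∈ₗ xs → x ≤ foldr _⊔_ a xs
  ≤-foldr-⊔ a (here refl) = m≤m⊔n _ _
  ≤-foldr-⊔ a (there x∈xs) = ≤-trans (≤-foldr-⊔ a x∈xs) (m≤n⊔m _ _)

m≤[1+m/n]*n : ∀ m n .{{_ : NonZero n}} → m ≤ suc (m / n) * n
m≤[1+m/n]*n m n = begin
  m                   ≡⟨ m≡m%n+[m/n]*n m n ⟩
  m % n + m / n * n   ≤⟨ +-monoˡ-≤ (m / n * n) (<⇒≤ (m%n<n m n)) ⟩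
  n + m / n * n       ∎
  where open ≤-Reasoning

[1+m/n]*n≤n+m : ∀ m n .{{_ : NonZero n}} → suc (m / n) * n ≤ n + m
[1+m/n]*n≤n+m m n = +-monoʳ-≤ n (m/n*n≤m m n)

log₂-bracket : ∀ d → 1 ≤ d → ∃[ ℓ ] (2 ^ ℓ ≤ d × d < 2 ^ suc ℓ)
log₂-bracket (suc zero)    _ = 0 , ≤-refl , s≤s (s≤s z≤n)
log₂-bracket (suc (suc d)) _ with log₂-bracket (suc d) (s≤s z≤n)
... | ℓ , 2^ℓ≤ , <2^[1+ℓ] with suc (suc d) <? 2 ^ suc ℓ
...   | yes <2^[1+ℓ]′ = ℓ , ≤-trans 2^ℓ≤ (n≤1+n _) , <2^[1+ℓ]′
...   | no  ≮2^[1+ℓ]  = suc ℓ , ≤-reflexive (sym d+2≡) , d+2<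
  where
  open ≤-Reasoning
  d+2≡ : suc (suc d) ≡ 2 ^ suc ℓ
  d+2≡ = ≤-antisym <2^[1+ℓ] (≮⇒≥ ≮2^[1+ℓ])
  d+2< : suc (suc d) < 2 ^ suc (suc ℓ)
  d+2< = begin-strict
    suc (suc d)           ≡⟨ d+2≡ ⟩
    2 ^ suc ℓ             <⟨ m<n+m (2 ^ suc ℓ) (m^n>0 2 (suc ℓ)) ⟩
    2 ^ suc ℓ + 2 ^ suc ℓ ≡⟨ cong (2 ^ suc ℓ +_) (+-identityʳ _) ⟨
    2 ^ suc (suc ℓ)       ∎

2^-≤-^ : ∀ {x δ ℓ N} → x ≤ ℓ * N → 2 ^ ℓ ≤ δ → 2 ^ x ≤ δ ^ N
2^-≤-^ {x} {δ} {ℓ} {N} x≤ℓN 2^ℓ≤δ = begin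
  2 ^ x        ≤⟨ ^-monoʳ-≤ 2 x≤ℓN ⟩
  2 ^ (ℓ * N)  ≡⟨ ^-*-assoc 2 ℓ N ⟨
  (2 ^ ℓ) ^ N  ≤⟨ ^-monoˡ-≤ N 2^ℓ≤δ ⟩
  δ ^ N        ∎
  where open ≤-Reasoning

1+x<2^[2+j] : ∀ {x} j → x ≤ 2 ^ j → suc x < 2 ^ suc (suc j)
1+x<2^[2+j] {x} j x≤2^j = begin-strict
  suc x                           ≤⟨ s≤s x≤2^j ⟩
  suc (2 ^ j)                     ≤⟨ +-monoˡ-≤ (2 ^ j) (m^n>0 2 j) ⟩
  2 ^ j + 2 ^ j                   <⟨ m<m+n (2 ^ j + 2 ^ j) (+-mono-< (m^n>0 2 j) (m^n>0 2 j)) ⟩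
  2 ^ j + 2 ^ j + (2 ^ j + 2 ^ j) ≡⟨ four-times (2 ^ j) ⟩
  2 * (2 * 2 ^ j)                 ∎
  where
  open ≤-Reasoning
  four-times : ∀ y → y + y + (y + y) ≡ 2 * (2 * y)
  four-times = solve-∀

2*[2^m∸1]≤2^n∸1 : ∀ {m n} → m < n → 2 * (2 ^ m ∸ 1) ≤ 2 ^ n ∸ 1
2*[2^m∸1]≤2^n∸1 {m} {n} m<n = begin
  2 * (2 ^ m ∸ 1) ≡⟨ *-distribˡ-∸ 2 (2 ^ m) 1 ⟩
  2 ^ suc m ∸ 2   ≤⟨ ∸-monoˡ-≤ 2 (^-monoʳ-≤ 2 m<n) ⟩
  2 ^ n ∸ 2       ≤⟨ ∸-monoʳ-≤ (2 ^ n) (s≤s z≤n) ⟩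
  2 ^ n ∸ 1       ∎
  where open ≤-Reasoning

2*[2^m∸1]+[2^n∸1]≤2*[2^n∸1] : ∀ n {m} → m ≤ n ∸ 1 → 2 * (2 ^ m ∸ 1) + (2 ^ n ∸ 1) ≤ 2 * (2 ^ n ∸ 1)
2*[2^m∸1]+[2^n∸1]≤2*[2^n∸1] zero    z≤n = z≤n
2*[2^m∸1]+[2^n∸1]≤2*[2^n∸1] (suc n) {m} m≤n = begin
  2 * (2 ^ m ∸ 1) + (2 ^ suc n ∸ 1)  ≤⟨ +-monoˡ-≤ _ (2*[2^m∸1]≤2^n∸1 (s≤s m≤n)) ⟩
  (2 ^ suc n ∸ 1) + (2 ^ suc n ∸ 1)  ≡⟨ cong ((2 ^ suc n ∸ 1) +_) (+-identityʳ _) ⟨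
  2 * (2 ^ suc n ∸ 1)                ∎
  where open ≤-Reasoning

module _ (a : ℕ → ℕ) (K d : ℕ) .{{_ : NonZero K}}
         (decrease : ∀ i → K * a (suc i) + d * a i ≤ K * a i) where

  sequence-mono : ∀ i → a (suc i) ≤ a i
  sequence-mono i = *-cancelˡ-≤ K (≤-trans (m≤m+n _ _) (decrease i))

  -- While a i > a 0 / 2, each step lowers 2 K a i by at least d a 0.
  linear-decrease : ∀ i → 2 * a i ≤ a 0 ⊎ 2 * K * a i + i * (d * a 0) ≤ 2 * K * a 0
  linear-decrease zero = inj₂ (≤-reflexive (+-identityʳ _))
  linear-decrease (suc i) with linear-decrease i | 2 * a i ≤? a 0
  ... | inj₁ halved | _ = inj₁ (≤-trans (*-monoʳ-≤ 2 (sequence-mono i)) halved)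
  ... | inj₂ _      | yes halved = inj₁ (≤-trans (*-monoʳ-≤ 2 (sequence-mono i)) halved)
  ... | inj₂ bound  | no  not-halved = inj₂ (begin
    2 * K * a (suc i) + (d * a 0 + i * (d * a 0)) ≡⟨ +-assoc (2 * K * a (suc i)) (d * a 0) (i * (d * a 0)) ⟨
    2 * K * a (suc i) + d * a 0 + i * (d * a 0)   ≤⟨ +-monoˡ-≤ (i * (d * a 0)) one-step ⟩
    2 * K * a i + i * (d * a 0)                   ≤⟨ bound ⟩
    2 * K * a 0                                 ∎)
    where
    open ≤-Reasoning
    one-step : 2 * K * a (suc i) + d * a 0 ≤ 2 * K * a i
    one-step = begin
      2 * K * a (suc i) + d * a 0       ≤⟨ +-monoʳ-≤ (2 * K * a (suc i)) (*-monoʳ-≤ d (<⇒≤ (≰⇒> not-halved))) ⟩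
      2 * K * a (suc i) + d * (2 * a i) ≡⟨ distribute K (a (suc i)) d (a i) ⟩
      2 * (K * a (suc i) + d * a i)     ≤⟨ *-monoʳ-≤ 2 (decrease i) ⟩
      2 * (K * a i)                     ≡⟨ *-assoc 2 K (a i) ⟨
      2 * K * a i                       ∎
      where
      distribute : ∀ K x d y → 2 * K * x + d * (2 * y) ≡ 2 * (K * x + d * y)
      distribute = solve-∀

  halving : ∀ L → 2 * K ≤ L * d → 2 * a L ≤ a 0
  halving L 2K≤Ld with linear-decrease L
  ... | inj₁ halved = halved
  ... | inj₂ bound  = ≤-trans (≤-reflexive 2aL≡0) z≤n
    where
    open ≤-Reasoning
    2KaL≤0 : 2 * K * a L ≤ 0
    2KaL≤0 = +-cancelʳ-≤ (L * (d * a 0)) _ _ (begin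
      2 * K * a L + L * (d * a 0) ≤⟨ bound ⟩
      2 * K * a 0                 ≤⟨ *-monoˡ-≤ (a 0) 2K≤Ld ⟩
      L * d * a 0                 ≡⟨ *-assoc L d (a 0) ⟩
      L * (d * a 0)               ∎)
    2aL≡0 : 2 * a L ≡ 0
    2aL≡0 = n≤0⇒n≡0 (begin
      2 * a L       ≤⟨ m≤n*m (2 * a L) K ⟩
      K * (2 * a L) ≡⟨ *-assoc K 2 (a L) ⟨
      K * 2 * a L   ≡⟨ cong (_* a L) (*-comm K 2) ⟩
      2 * K * a L   ≤⟨ 2KaL≤0 ⟩
      0             ∎)

decay : (a : ℕ → ℕ) (K d : ℕ) .{{_ : NonZero K}} → (∀ i → K * a (suc i) + d * a i ≤ K * a i) →
        ∀ L → 2 * K ≤ L * d → ∀ j → 2 ^ j * a (j * L) ≤ a 0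
decay a K d decrease L 2K≤Ld zero    = ≤-reflexive (+-identityʳ (a 0))
decay a K d decrease L 2K≤Ld (suc j) = begin
  2 * 2 ^ j * a (L + j * L)   ≡⟨ cong (_* a (L + j * L)) (*-comm 2 (2 ^ j)) ⟩
  2 ^ j * 2 * a (L + j * L)   ≡⟨ *-assoc (2 ^ j) 2 (a (L + j * L)) ⟩
  2 ^ j * (2 * a (L + j * L)) ≤⟨ *-monoʳ-≤ (2 ^ j) (halving shifted K d (λ i → decrease (i + j * L)) L 2K≤Ld) ⟩
  2 ^ j * a (j * L)           ≤⟨ decay a K d decrease L 2K≤Ld j ⟩
  a 0                         ∎
  where
  open ≤-Reasoning
  shifted : ℕ → ℕ
  shifted i = a (i + j * L)

weight-step : ∀ m a a′ b → b ≤ 1 → a + b ≤ a′ →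
              2 * (2 ^ (m ∸ a′) ∸ 1) + (2 ^ (m ∸ a) ∸ 1) * b ≤ 2 * (2 ^ (m ∸ a) ∸ 1)
weight-step m a a′ zero _ a+0≤a′ = begin
  2 * (2 ^ (m ∸ a′) ∸ 1) + (2 ^ (m ∸ a) ∸ 1) * 0 ≡⟨ cong (2 * (2 ^ (m ∸ a′) ∸ 1) +_) (*-zeroʳ (2 ^ (m ∸ a) ∸ 1)) ⟩
  2 * (2 ^ (m ∸ a′) ∸ 1) + 0                     ≡⟨ +-identityʳ _ ⟩
  2 * (2 ^ (m ∸ a′) ∸ 1)                         ≤⟨ *-monoʳ-≤ 2 (∸-monoˡ-≤ 1 (^-monoʳ-≤ 2 (∸-monoʳ-≤ m a≤a′))) ⟩
  2 * (2 ^ (m ∸ a) ∸ 1)                          ∎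
  where
  open ≤-Reasoning
  a≤a′ : a ≤ a′
  a≤a′ = ≤-trans (m≤m+n a 0) a+0≤a′
weight-step m a a′ (suc zero) _ a+1≤a′ = begin
  2 * (2 ^ (m ∸ a′) ∸ 1) + (2 ^ (m ∸ a) ∸ 1) * 1 ≡⟨ cong (2 * (2 ^ (m ∸ a′) ∸ 1) +_) (*-identityʳ (2 ^ (m ∸ a) ∸ 1)) ⟩
  2 * (2 ^ (m ∸ a′) ∸ 1) + (2 ^ (m ∸ a) ∸ 1)     ≤⟨ 2*[2^m∸1]+[2^n∸1]≤2*[2^n∸1] (m ∸ a) d′≤d∸1 ⟩
  2 * (2 ^ (m ∸ a) ∸ 1)                          ∎
  where
  open ≤-Reasoning
  d′≤d∸1 : m ∸ a′ ≤ m ∸ a ∸ 1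
  d′≤d∸1 = ≤-trans (∸-monoʳ-≤ m a+1≤a′) (≤-reflexive (sym (∸-+-assoc m a 1)))
weight-step m a a′ (suc (suc _)) (s≤s ()) _

module Potential {n : ℕ} (G : Graph n) (m : ℕ) where

  nbrsIn : (Fin n → Bool) → Fin n → ℕ
  nbrsIn S u = count (λ w → adj G u w ∧ S w)

  nbrsOut : (Fin n → Bool) → Fin n → ℕ
  nbrsOut S u = count (λ w → adj G u w ∧ not (S w))

  deficit : (Fin n → Bool) → Fin n → ℕ
  deficit S u = m ∸ nbrsIn S u

  weight : (Fin n → Bool) → Fin n → ℕ
  weight S u = if S u then 0 else 2 ^ deficit S u ∸ 1

  potential : (Fin n → Bool) → ℕ
  potential S = ∑[ u < n ] weight S u

  gain : (Fin n → Bool) → Fin n → ℕ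
  gain S w = ∑[ u < n ] (weight S u * 𝟙 (adj G u w ∧ not (S w)))

  insert : (Fin n → Bool) → Fin n → Fin n → Bool
  insert S w v = S v ∨ does (v ≟ w)

  nbrsIn-insert : ∀ S w u → nbrsIn S u + 𝟙 (adj G u w ∧ not (S w)) ≤ nbrsIn (insert S w) u
  nbrsIn-insert S w u = begin
    nbrsIn S u + 𝟙 (adj G u w ∧ not (S w))
      ≡⟨ cong (nbrsIn S u +_) (sum-select w (λ v → 𝟙 (adj G u v ∧ not (S v)))) ⟨
    nbrsIn S u + ∑[ v < n ] (𝟙 (does (v ≟ w)) * 𝟙 (adj G u v ∧ not (S v)))
      ≡⟨ ∑-distrib-+ (λ v → 𝟙 (adj G u v ∧ S v)) (λ v → 𝟙 (does (v ≟ w)) * 𝟙 (adj G u v ∧ not (S v))) ⟨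
    ∑[ v < n ] (𝟙 (adj G u v ∧ S v) + 𝟙 (does (v ≟ w)) * 𝟙 (adj G u v ∧ not (S v)))
      ≤⟨ sum-mono-≤ (λ v → 𝟙-insert (adj G u v) (S v) (does (v ≟ w))) ⟩
    nbrsIn (insert S w) u ∎
    where
    open ≤-Reasoning
    𝟙-insert : ∀ a s e → 𝟙 (a ∧ s) + 𝟙 e * 𝟙 (a ∧ not s) ≤ 𝟙 (a ∧ (s ∨ e))
    𝟙-insert true  true  e     = ≤-reflexive (cong suc (*-zeroʳ (𝟙 e)))
    𝟙-insert true  false true  = s≤s z≤n
    𝟙-insert true  false false = z≤n
    𝟙-insert false s     e     = ≤-reflexive (*-zeroʳ (𝟙 e))

  weight-insert : ∀ S w u → 2 * weight (insert S w) u + weight S u * 𝟙 (adj G u w ∧ not (S w)) ≤ 2 * weight S u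
  weight-insert S w u with S u | does (u ≟ w)
  ... | true  | _     = z≤n
  ... | false | true  = x*𝟙b≤2*x (2 ^ deficit S u ∸ 1) (adj G u w ∧ not (S w))
    where
    x*𝟙b≤2*x : ∀ x b → x * 𝟙 b ≤ 2 * x
    x*𝟙b≤2*x x b = ≤-trans (*-monoʳ-≤ x (𝟙≤1 b)) (≤-trans (≤-reflexive (*-identityʳ x)) (m≤n*m x 2))
  ... | false | false =
    weight-step m (nbrsIn S u) (nbrsIn (insert S w) u) _ (𝟙≤1 _) (nbrsIn-insert S w u)

  potential-insert : ∀ S w → 2 * potential (insert S w) + gain S w ≤ 2 * potential S
  potential-insert S w = begin
    2 * potential (insert S w) + gain S w
      ≡⟨ cong (_+ gain S w) (*-distribˡ-sum 2 (weight (insert S w))) ⟩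
    ∑[ u < n ] (2 * weight (insert S w) u) + gain S w
      ≡⟨ ∑-distrib-+ (λ u → 2 * weight (insert S w) u) (λ u → weight S u * 𝟙 (adj G u w ∧ not (S w))) ⟨
    ∑[ u < n ] (2 * weight (insert S w) u + weight S u * 𝟙 (adj G u w ∧ not (S w)))
      ≤⟨ sum-mono-≤ (weight-insert S w) ⟩
    ∑[ u < n ] (2 * weight S u)
      ≡⟨ *-distribˡ-sum 2 (weight S) ⟨
    2 * potential S ∎
    where open ≤-Reasoning

  ∑-gain : ∀ S → ∑[ w < n ] gain S w ≡ ∑[ u < n ] (weight S u * nbrsOut S u)
  ∑-gain S = trans (∑-comm (λ w u → weight S u * 𝟙 (adj G u w ∧ not (S w))))
    (sum-cong-≗ (λ u → sym (*-distribˡ-sum (weight S u) (λ w → 𝟙 (adj G u w ∧ not (S w))))))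

  weight-≡0 : ∀ S u → m ≤ nbrsIn S u → weight S u ≡ 0
  weight-≡0 S u m≤a with S u
  ... | true  = refl
  ... | false = cong (λ d → 2 ^ d ∸ 1) (m≤n⇒m∸n≡0 m≤a)

  weight-≤ : ∀ S u → weight S u ≤ 2 ^ m
  weight-≤ S u with S u
  ... | true  = z≤n
  ... | false = ≤-trans (m∸n≤m _ 1) (^-monoʳ-≤ 2 (m∸n≤m m (nbrsIn S u)))

  potential-≤ : ∀ S → potential S ≤ n * 2 ^ m
  potential-≤ S = sum-≤-* (2 ^ m) (weight S) (weight-≤ S)

  count-insert : ∀ S w → count (insert S w) ≤ count S + 1
  count-insert S w = begin
    count (insert S w)                                 ≤⟨ count-∨ S (λ v → does (v ≟ w)) ⟩
    count S + count (λ v → not (S v) ∧ does (v ≟ w))  ≤⟨ +-monoʳ-≤ (count S) (sum-mono-≤ λ v → 𝟙-∧≤ (not (S v)) _) ⟩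
    count S + ∑[ v < n ] (𝟙 (does (v ≟ w)) * 1)       ≡⟨ cong (count S +_) (sum-select w (λ _ → 1)) ⟩
    count S + 1                                        ∎
    where
    open ≤-Reasoning
    𝟙-∧≤ : ∀ a b → 𝟙 (a ∧ b) ≤ 𝟙 b * 1
    𝟙-∧≤ true  true  = ≤-refl
    𝟙-∧≤ true  false = z≤n
    𝟙-∧≤ false b     = z≤n

  undominated : (Fin n → Bool) → Fin n → Bool
  undominated S u = not (S u) ∧ not (m ≤ᵇ nbrsIn S u)

  count-undominated≤potential : ∀ S → count (undominated S) ≤ potential S
  count-undominated≤potential S = sum-mono-≤ 𝟙≤weight
    where
    𝟙≤weight : ∀ u → 𝟙 (undominated S u) ≤ weight S u
    𝟙≤weight u with S u | m ≤ᵇ nbrsIn S u | ≤ᵇ-reflects-≤ m (nbrsIn S u)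
    ... | true  | _     | _       = z≤n
    ... | false | true  | _       = z≤n
    ... | false | false | ofⁿ m≰a = begin
      1                      ≤⟨ ∸-monoˡ-≤ 1 (^-monoʳ-≤ 2 (m<n⇒0<n∸m (≰⇒> m≰a))) ⟩
      2 ^ deficit S u ∸ 1    ∎
      where open ≤-Reasoning

  nbrsIn-∨ : ∀ (S X : Fin n → Bool) u → nbrsIn S u ≤ nbrsIn (λ w → S w ∨ X w) u
  nbrsIn-∨ S X u = sum-mono-≤ (λ w → 𝟙-∧-∨ (adj G u w) (S w) (X w))
    where
    𝟙-∧-∨ : ∀ a s x → 𝟙 (a ∧ s) ≤ 𝟙 (a ∧ (s ∨ x))
    𝟙-∧-∨ true  true  x = ≤-refl
    𝟙-∧-∨ true  false x = z≤n
    𝟙-∧-∨ false s     x = z≤n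

  addUndominated : (Fin n → Bool) → Fin n → Bool
  addUndominated S u = S u ∨ not (m ≤ᵇ nbrsIn S u)

  count-addUndominated : ∀ S → count (addUndominated S) ≤ count S + count (undominated S)
  count-addUndominated S = count-∨ S (λ u → not (m ≤ᵇ nbrsIn S u))

  addUndominated-dominates : ∀ S u → addUndominated S u ≡ false → m ≤ nbrsIn (addUndominated S) u
  addUndominated-dominates S u notAdded with S u | m ≤ᵇ nbrsIn S u | ≤ᵇ-reflects-≤ m (nbrsIn S u)
  ... | false | true | ofʸ m≤a = ≤-trans m≤a (nbrsIn-∨ S (λ w → not (m ≤ᵇ nbrsIn S w)) u)

module Greedy {n′ : ℕ} (G : Graph (suc n′)) (m δ : ℕ)
              (δ≤deg : ∀ v → δ ≤ count (adj G v)) (2m≤δ : 2 * m ≤ δ) where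

  open Potential G m

  n : ℕ
  n = suc n′

  undominated⇒δ≤2*nbrsOut : ∀ S u → nbrsIn S u < m → δ ≤ 2 * nbrsOut S u
  undominated⇒δ≤2*nbrsOut S u a<m = begin
    δ                       ≤⟨ δ≤m+out ⟩
    m + nbrsOut S u         ≤⟨ +-monoˡ-≤ (nbrsOut S u) m≤out ⟩
    nbrsOut S u + nbrsOut S u ≡⟨ cong (nbrsOut S u +_) (+-identityʳ _) ⟨
    2 * nbrsOut S u         ∎
    where
    open ≤-Reasoning
    δ≤m+out : δ ≤ m + nbrsOut S u
    δ≤m+out = begin
      δ                           ≤⟨ δ≤deg u ⟩
      count (adj G u)             ≡⟨ count-split (adj G u) S ⟨
      nbrsIn S u + nbrsOut S u    ≤⟨ +-monoˡ-≤ (nbrsOut S u) (<⇒≤ a<m) ⟩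
      m + nbrsOut S u             ∎
    m≤out : m ≤ nbrsOut S u
    m≤out = +-cancelˡ-≤ m m (nbrsOut S u) (begin
      m + m         ≡⟨ cong (m +_) (+-identityʳ m) ⟨
      2 * m         ≤⟨ 2m≤δ ⟩
      δ             ≤⟨ δ≤m+out ⟩
      m + nbrsOut S u ∎)

  δ*weight≤2*weight*nbrsOut : ∀ S u → δ * weight S u ≤ 2 * (weight S u * nbrsOut S u)
  δ*weight≤2*weight*nbrsOut S u with m ≤? nbrsIn S u
  ... | yes m≤a rewrite weight-≡0 S u m≤a | *-zeroʳ δ = z≤n
  ... | no  m≰a = begin
    δ * weight S u                   ≤⟨ *-monoˡ-≤ (weight S u) (undominated⇒δ≤2*nbrsOut S u (≰⇒> m≰a)) ⟩
    2 * nbrsOut S u * weight S u     ≡⟨ *-assoc 2 (nbrsOut S u) (weight S u) ⟩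
    2 * (nbrsOut S u * weight S u)   ≡⟨ cong (2 *_) (*-comm (nbrsOut S u) (weight S u)) ⟩
    2 * (weight S u * nbrsOut S u)   ∎
    where open ≤-Reasoning

  best : (Fin n → Bool) → Fin n
  best S = proj₁ (sum-≤-*-argmax (gain S))

  δ*potential≤2*n*gain-best : ∀ S → δ * potential S ≤ 2 * (n * gain S (best S))
  δ*potential≤2*n*gain-best S = begin
    δ * potential S                              ≡⟨ *-distribˡ-sum δ (weight S) ⟩
    ∑[ u < n ] (δ * weight S u)                  ≤⟨ sum-mono-≤ (δ*weight≤2*weight*nbrsOut S) ⟩
    ∑[ u < n ] (2 * (weight S u * nbrsOut S u))  ≡⟨ *-distribˡ-sum 2 (λ u → weight S u * nbrsOut S u) ⟨
    2 * ∑[ u < n ] (weight S u * nbrsOut S u)    ≡⟨ cong (2 *_) (∑-gain S) ⟨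
    2 * ∑[ w < n ] gain S w                      ≤⟨ *-monoʳ-≤ 2 (proj₂ (sum-≤-*-argmax (gain S))) ⟩
    2 * (n * gain S (best S))                    ∎
    where open ≤-Reasoning

  greedyStep : (Fin n → Bool) → Fin n → Bool
  greedyStep S = insert S (best S)

  potential-greedyStep : ∀ S → 4 * n * potential (greedyStep S) + δ * potential S ≤ 4 * n * potential S
  potential-greedyStep S = begin
    4 * n * Φ′ + δ * potential S      ≤⟨ +-monoʳ-≤ (4 * n * Φ′) (δ*potential≤2*n*gain-best S) ⟩
    4 * n * Φ′ + 2 * (n * g)          ≡⟨ regroup n Φ′ g ⟩
    2 * n * (2 * Φ′ + g)              ≤⟨ *-monoʳ-≤ (2 * n) (potential-insert S (best S)) ⟩
    2 * n * (2 * potential S)         ≡⟨ regroup′ n (potential S) ⟩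
    4 * n * potential S               ∎
    where
    open ≤-Reasoning
    Φ′ g : ℕ
    Φ′ = potential (greedyStep S)
    g  = gain S (best S)
    regroup : ∀ n x y → 4 * n * x + 2 * (n * y) ≡ 2 * n * (2 * x + y)
    regroup = solve-∀
    regroup′ : ∀ n x → 2 * n * (2 * x) ≡ 4 * n * x
    regroup′ = solve-∀

  greedySet : ℕ → Fin n → Bool
  greedySet = fold (λ _ → false) greedyStep

  count-greedySet≤ : ∀ i → count (greedySet i) ≤ i
  count-greedySet≤ zero    = ≤-reflexive (sum-replicate-zero n)
  count-greedySet≤ (suc i) = begin
    count (greedyStep (greedySet i)) ≤⟨ count-insert (greedySet i) (best (greedySet i)) ⟩
    count (greedySet i) + 1          ≤⟨ +-monoˡ-≤ 1 (count-greedySet≤ i) ⟩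
    i + 1                            ≡⟨ +-comm i 1 ⟩
    suc i                            ∎
    where open ≤-Reasoning

  greedyDominatingSet : ∀ ℓ L → δ ≤ 2 ^ ℓ → 8 * n ≤ L * δ →
    ∃[ S ] (count S * δ ≤ (m + ℓ) * L * δ + n × (∀ u → S u ≡ false → m ≤ nbrsIn S u))
  greedyDominatingSet ℓ L δ≤2^ℓ 8n≤Lδ =
    addUndominated S₀ , size , addUndominated-dominates S₀
    where
    open ≤-Reasoning
    T : ℕ
    T = (m + ℓ) * L
    S₀ : Fin n → Bool
    S₀ = greedySet T
    Φ : ℕ
    Φ = potential S₀
    2^[m+ℓ]*Φ≤ : 2 ^ (m + ℓ) * Φ ≤ n * 2 ^ m
    2^[m+ℓ]*Φ≤ = ≤-trans
      (decay (λ i → potential (greedySet i)) (4 * n) δ (λ i → potential-greedyStep (greedySet i))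
             L (≤-trans (≤-reflexive (sym (*-assoc 2 4 n))) 8n≤Lδ) (m + ℓ))
      (potential-≤ (λ _ → false))
    δ*Φ≤n : δ * Φ ≤ n
    δ*Φ≤n = *-cancelˡ-≤ (2 ^ m) {{m^n≢0 2 m}} (begin
      2 ^ m * (δ * Φ)      ≤⟨ *-monoʳ-≤ (2 ^ m) (*-monoˡ-≤ Φ δ≤2^ℓ) ⟩
      2 ^ m * (2 ^ ℓ * Φ)  ≡⟨ *-assoc (2 ^ m) (2 ^ ℓ) Φ ⟨
      2 ^ m * 2 ^ ℓ * Φ    ≡⟨ cong (_* Φ) (^-distribˡ-+-* 2 m ℓ) ⟨
      2 ^ (m + ℓ) * Φ      ≤⟨ 2^[m+ℓ]*Φ≤ ⟩
      n * 2 ^ m            ≡⟨ *-comm n (2 ^ m) ⟩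
      2 ^ m * n            ∎)
    size : count (addUndominated S₀) * δ ≤ T * δ + n
    size = begin
      count (addUndominated S₀) * δ            ≤⟨ *-monoˡ-≤ δ (count-addUndominated S₀) ⟩
      (count S₀ + count (undominated S₀)) * δ
        ≤⟨ *-monoˡ-≤ δ (+-mono-≤ (count-greedySet≤ T) (count-undominated≤potential S₀)) ⟩
      (T + Φ) * δ                              ≡⟨ *-distribʳ-+ δ T Φ ⟩
      T * δ + Φ * δ                            ≤⟨ +-monoʳ-≤ (T * δ) (≤-trans (≤-reflexive (*-comm Φ δ)) δ*Φ≤n) ⟩
      T * δ + n                                ∎

  greedyDominatingSet′ : 1 ≤ δ → ∀ ℓ → δ ≤ 2 ^ ℓ →
    ∃[ S ] (count S * δ ≤ n * (9 * (m + ℓ) + 1) × (∀ u → S u ≡ false → m ≤ nbrsIn S u))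
  greedyDominatingSet′ 1≤δ ℓ δ≤2^ℓ = rebound (greedyDominatingSet ℓ L δ≤2^ℓ (m≤[1+m/n]*n (8 * n) δ))
    where
    open ≤-Reasoning
    instance
      δ≢0 : NonZero δ
      δ≢0 = >-nonZero 1≤δ
    L : ℕ
    L = suc (8 * n / δ)
    Lδ≤9n : L * δ ≤ 9 * n
    Lδ≤9n = begin
      L * δ     ≤⟨ [1+m/n]*n≤n+m (8 * n) δ ⟩
      δ + 8 * n ≤⟨ +-monoˡ-≤ (8 * n) (≤-trans (δ≤deg zero) (count-≤ (adj G zero))) ⟩
      n + 8 * n ∎
    regroup : ∀ x n → x * (9 * n) + n ≡ n * (9 * x + 1)
    regroup = solve-∀
    bound : (m + ℓ) * L * δ + n ≤ n * (9 * (m + ℓ) + 1)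
    bound = begin
      (m + ℓ) * L * δ + n        ≡⟨ cong (_+ n) (*-assoc (m + ℓ) L δ) ⟩
      (m + ℓ) * (L * δ) + n      ≤⟨ +-monoˡ-≤ n (*-monoʳ-≤ (m + ℓ) Lδ≤9n) ⟩
      (m + ℓ) * (9 * n) + n      ≡⟨ regroup (m + ℓ) n ⟩
      n * (9 * (m + ℓ) + 1)      ∎
    rebound : ∃[ S ] (count S * δ ≤ (m + ℓ) * L * δ + n × (∀ u → S u ≡ false → m ≤ nbrsIn S u)) →
              ∃[ S ] (count S * δ ≤ n * (9 * (m + ℓ) + 1) × (∀ u → S u ≡ false → m ≤ nbrsIn S u))
    rebound (S , size , dominated) = S , ≤-trans size bound , dominated

multipleDominatingSet : ∀ {n′} (G : Graph (suc n′)) m ℓ → 1 ≤ minDeg G → minDeg G ≤ 2 ^ ℓ →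
  ∃[ S ] (count S * minDeg G ≤ suc n′ * (9 * (m + ℓ) + 1) ×
          (∀ u → S u ≡ false → m ≤ count (λ w → adj G u w ∧ S w)))
multipleDominatingSet {n′} G m ℓ 1≤δ δ≤2^ℓ with 2 * m ≤? minDeg G
... | no 2m≰δ = (λ _ → true) , (begin
  count {n} (λ _ → true) * δ   ≤⟨ *-monoˡ-≤ δ (count-≤ {n} (λ _ → true)) ⟩
  n * δ                        ≤⟨ *-monoʳ-≤ n δ≤ ⟩
  n * (9 * (m + ℓ) + 1)        ∎) , λ u ()
  where
  open ≤-Reasoning
  n δ : ℕ
  n = suc n′
  δ = minDeg G
  δ≤ : δ ≤ 9 * (m + ℓ) + 1
  δ≤ = begin
    δ                ≤⟨ <⇒≤ (≰⇒> 2m≰δ) ⟩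
    2 * m            ≤⟨ *-monoˡ-≤ m (s≤s (s≤s (z≤n {7}))) ⟩
    9 * m            ≤⟨ *-monoʳ-≤ 9 (m≤m+n m ℓ) ⟩
    9 * (m + ℓ)      ≤⟨ m≤m+n _ 1 ⟩
    9 * (m + ℓ) + 1  ∎
... | yes 2m≤δ = Greedy.greedyDominatingSet′ G m (minDeg G) (minDeg≤deg G) 2m≤δ 1≤δ ℓ δ≤2^ℓ

∷-≢ : ∀ {k} b (X : Subset k) (Z : Subset (suc k)) → (head Z ≡ b → X ≢ tail Z) → b ∷ X ≢ Z
∷-≢ b X Z avoid b∷X≡Z = avoid (sym (cong head b∷X≡Z)) (cong tail b∷X≡Z)

module _ {k r} (p : Fin r → Bool) (Y : Fin r → Subset (suc k)) where

  headIn headOut : Fin r → Bool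
  headIn  i = p i ∧ head (Y i)
  headOut i = p i ∧ not (head (Y i))

  count-headIn+headOut : count headIn + count headOut ≡ count p
  count-headIn+headOut = count-split p (λ i → head (Y i))

  outside∷-fresh : ∀ X → (∀ i → headOut i ≡ true → X ≢ tail (Y i)) → ∀ i → p i ≡ true → outside ∷ X ≢ Y i
  outside∷-fresh X fresh i pi = ∷-≢ outside X (Y i) (λ hd → fresh i (cong₂ (λ a h → a ∧ not h) pi hd))

  inside∷-fresh : ∀ X → (∀ i → headIn i ≡ true → X ≢ tail (Y i)) → ∀ i → p i ≡ true → inside ∷ X ≢ Y i
  inside∷-fresh X fresh i pi = ∷-≢ inside X (Y i) (λ hd → fresh i (cong₂ _∧_ pi hd))

-- A set with a elements has 2 ^ a subsets, so fewer than 2 ^ a sets cannot exhaust them.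
fresh-subset : ∀ {k r} (A : Subset k) (p : Fin r → Bool) (Y : Fin r → Subset k) → count p < 2 ^ ∣ A ∣ →
               ∃[ X ] (X ⊆ A × (∀ i → p i ≡ true → X ≢ Y i))
fresh-subset [] p Y p<1 = [] , ⊆-refl , λ i pi → ⊥-elim (<⇒≱ (count-pos p i pi) (≤-pred p<1))
fresh-subset (outside ∷ A) p Y p<2^a
  with fresh-subset A (headOut p Y) (λ i → tail (Y i))
         (≤-<-trans (≤-trans (m≤n+m _ _) (≤-reflexive (count-headIn+headOut p Y))) p<2^a)
... | X , X⊆A , fresh = outside ∷ X , out⊆ X⊆A , outside∷-fresh p Y X fresh
fresh-subset (inside ∷ A) p Y p<2^[1+a] with count (headOut p Y) <? 2 ^ ∣ A ∣
... | yes out<2^a with fresh-subset A (headOut p Y) (λ i → tail (Y i)) out<2^a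
...   | X , X⊆A , fresh = outside ∷ X , out⊆ X⊆A , outside∷-fresh p Y X fresh
fresh-subset (inside ∷ A) p Y p<2^[1+a] | no out≮2^a
  with fresh-subset A (headIn p Y) (λ i → tail (Y i)) in<2^a
  where
  open ≤-Reasoning
  in<2^a : count (headIn p Y) < 2 ^ ∣ A ∣
  in<2^a = +-cancelʳ-< (count (headOut p Y)) _ _ (begin-strict
    count (headIn p Y) + count (headOut p Y) ≡⟨ count-headIn+headOut p Y ⟩
    count p                                  <⟨ p<2^[1+a] ⟩
    2 ^ ∣ A ∣ + (2 ^ ∣ A ∣ + 0)              ≡⟨ cong (2 ^ ∣ A ∣ +_) (+-identityʳ _) ⟩
    2 ^ ∣ A ∣ + 2 ^ ∣ A ∣                    ≤⟨ +-monoʳ-≤ (2 ^ ∣ A ∣) (≮⇒≥ out≮2^a) ⟩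
    2 ^ ∣ A ∣ + count (headOut p Y)          ∎)
...   | X , X⊆A , fresh = inside ∷ X , in⊆in X⊆A , inside∷-fresh p Y X fresh

≢⊥⇒Nonempty : ∀ {k} {X : Subset k} → X ≢ ⊥ → Nonempty X
≢⊥⇒Nonempty {X = X} X≢⊥ with nonempty? X
... | yes ne = ne
... | no  empty = ⊥-elim (X≢⊥ (Empty-unique empty))

candidatesIn : ∀ {n} → Graph n → (Fin n → Bool) → Fin n → Subset n
candidatesIn G S u = tabulate (λ w → adj G u w ∧ S w)

∈-candidatesIn : ∀ {n} (G : Graph n) S {u w} → w ∈ candidatesIn G S u → (adj G u w ∧ S w) ≡ true
∈-candidatesIn G S {u} {w} w∈ = trans (sym (lookup∘tabulate (λ w → adj G u w ∧ S w) w)) ([]=⇒lookup w∈)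

precedes : ∀ {k} → Fin k → Fin k → Bool
precedes zero    zero    = false
precedes zero    (suc _) = true
precedes (suc _) zero    = false
precedes (suc i) (suc j) = precedes i j

precedes-antisym : ∀ {k} (i j : Fin k) → i ≢ j → precedes i j ≡ not (precedes j i)
precedes-antisym zero    zero    i≢j = ⊥-elim (i≢j refl)
precedes-antisym zero    (suc j) _   = refl
precedes-antisym (suc i) zero    _   = refl
precedes-antisym (suc i) (suc j) i≢j = precedes-antisym i j (λ i≡j → i≢j (cong suc i≡j))

orientBy : ∀ {n} (G : Graph n) (prefer : Fin n → Fin n → Bool) →
           (∀ u v → u ≢ v → prefer u v ≡ not (prefer v u)) → Orientation G
orientBy G prefer antisym = record
  { dir     = λ u v → adj G u v ∧ prefer u v
  ; onEdges = λ u v → ∧-conicalˡ _ _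
  ; oneWay  = oneWay′
  }
  where
  oneWay′ : ∀ u v → adj G u v ≡ true → (adj G u v ∧ prefer u v) ≡ not (adj G v u ∧ prefer v u)
  oneWay′ u v u∼v rewrite u∼v | trans (Graph.sym G v u) u∼v = antisym u v u≢v
    where
    u≢v : u ≢ v
    u≢v refl with trans (sym u∼v) (Graph.irrefl G u)
    ... | ()

module LabelOrientation {n : ℕ} (G : Graph n) (S : Fin n → Bool) (I : Fin n → Subset n) where

  -- An edge between a ∈ S and b ∉ S points to b exactly when a belongs to the label of b.
  towards : Bool → Bool → Fin n → Fin n → Bool
  towards true  false a b = lookup (I b) a
  towards false true  a b = not (lookup (I a) b)
  towards true  true  a b = precedes a b
  towards false false a b = precedes a b

  towards-antisym : ∀ sa sb a b → a ≢ b → towards sa sb a b ≡ not (towards sb sa b a)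
  towards-antisym true  false a b _   = sym (not-involutive _)
  towards-antisym false true  a b _   = refl
  towards-antisym true  true  a b a≢b = precedes-antisym a b a≢b
  towards-antisym false false a b a≢b = precedes-antisym a b a≢b

  orientation : Orientation G
  orientation = orientBy G (λ a b → towards (S a) (S b) a b) (λ a b → towards-antisym (S a) (S b) a b)

  inNbrsIn-orientation : ∀ u → S u ≡ false → I u ⊆ candidatesIn G S u → inNbrsIn orientation (tabulate S) u ≡ I u
  inNbrsIn-orientation u Su Iu⊆ = trans (tabulate-cong in-label) (tabulate∘lookup (I u))
    where
    in-label : ∀ w → (lookup (tabulate S) w ∧ (adj G w u ∧ towards (S w) (S u) w u)) ≡ lookup (I u) w
    in-label w rewrite lookup∘tabulate S w | Su with S w in Sw
    ... | true with lookup (I u) w in w∈Iu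
    ...   | false = ∧-zeroʳ (adj G w u)
    ...   | true  rewrite Graph.sym G w u =
      trans (∧-identityʳ (adj G u w)) (∧-conicalˡ _ _ (∈-candidatesIn G S (Iu⊆ (lookup⇒[]= w (I u) w∈Iu))))
    in-label w | false with lookup (I u) w in w∈Iu
    ...   | false = refl
    ...   | true  with trans (sym (∧-conicalʳ _ _ (∈-candidatesIn G S (Iu⊆ (lookup⇒[]= w (I u) w∈Iu))))) Sw
    ...     | ()

module Labelling {n : ℕ} (G : Graph n) (S : Fin n → Bool) (m Δ : ℕ)
                 (dominated : ∀ u → S u ≡ false → m ≤ count (λ w → adj G u w ∧ S w))
                 (deg≤Δ : ∀ v → count (adj G v) ≤ Δ) (1+Δ²<2^m : suc (Δ * Δ) < 2 ^ m) where

  candidates : Fin n → Subset n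
  candidates = candidatesIn G S

  shareNbr : Fin n → Fin n → Bool
  shareNbr u v = 0 <ᵇ count (λ w → adj G u w ∧ adj G w v)

  shareNbr-intro : ∀ {u w v} → adj G u w ≡ true → adj G w v ≡ true → shareNbr u v ≡ true
  shareNbr-intro {u} {w} {v} uw wv with count (λ w → adj G u w ∧ adj G w v)
                                  | count-pos (λ w → adj G u w ∧ adj G w v) w (cong₂ _∧_ uw wv)
  ... | suc _ | _ = refl

  count-shareNbr : ∀ u → count (shareNbr u) ≤ Δ * Δ
  count-shareNbr u = begin
    count (shareNbr u)
      ≤⟨ sum-mono-≤ (λ v → 𝟙[0<ᵇ]≤ (count (λ w → adj G u w ∧ adj G w v))) ⟩
    ∑[ v < n ] ∑[ w < n ] 𝟙 (adj G u w ∧ adj G w v)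
      ≡⟨ ∑-comm (λ v w → 𝟙 (adj G u w ∧ adj G w v)) ⟩
    ∑[ w < n ] ∑[ v < n ] 𝟙 (adj G u w ∧ adj G w v)
      ≡⟨ sum-cong-≗ (λ w → trans (sum-cong-≗ (λ v → 𝟙-∧ (adj G u w) (adj G w v)))
                                 (sym (*-distribˡ-sum (𝟙 (adj G u w)) (λ v → 𝟙 (adj G w v))))) ⟩
    ∑[ w < n ] (𝟙 (adj G u w) * count (adj G w))
      ≤⟨ sum-mono-≤ (λ w → *-monoʳ-≤ (𝟙 (adj G u w)) (deg≤Δ w)) ⟩
    ∑[ w < n ] (𝟙 (adj G u w) * Δ)
      ≡⟨ sum-cong-≗ (λ w → *-comm (𝟙 (adj G u w)) Δ) ⟩
    ∑[ w < n ] (Δ * 𝟙 (adj G u w))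
      ≡⟨ *-distribˡ-sum Δ (λ w → 𝟙 (adj G u w)) ⟨
    Δ * count (adj G u)
      ≤⟨ *-monoʳ-≤ Δ (deg≤Δ u) ⟩
    Δ * Δ ∎
    where open ≤-Reasoning

  -- An empty label marks a vertex that has not been labelled yet.
  record ValidLabelling (I : Fin n → Subset n) : Set where
    field
      ⊆-candidates : ∀ v → Nonempty (I v) → S v ≡ false × I v ⊆ candidates v
      distinct     : ∀ u v → u ≢ v → Nonempty (I u) → I u ≢ I v
  open ValidLabelling

  valid-⊥ : ValidLabelling (λ _ → ⊥)
  valid-⊥ = record { ⊆-candidates = λ v (_ , x∈⊥) → ⊥-elim (∉⊥ x∈⊥)
                    ; distinct     = λ u v _ (_ , x∈⊥) → ⊥-elim (∉⊥ x∈⊥) }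

  fresh-label : ∀ u (I : Fin n → Subset n) → S u ≡ false →
    ∃[ X ] (X ⊆ candidates u × Nonempty X × (∀ v → shareNbr u v ≡ true → X ≢ I v))
  -- Index zero excludes the empty set.
  fresh-label u I Su with fresh-subset (candidates u) (true Vector.∷ shareNbr u) (⊥ Vector.∷ I) bound
    where
    open ≤-Reasoning
    bound : suc (count (shareNbr u)) < 2 ^ ∣ candidates u ∣
    bound = begin-strict
      suc (count (shareNbr u))          ≤⟨ s≤s (count-shareNbr u) ⟩
      suc (Δ * Δ)                       <⟨ 1+Δ²<2^m ⟩
      2 ^ m                             ≤⟨ ^-monoʳ-≤ 2 (dominated u Su) ⟩
      2 ^ count (λ w → adj G u w ∧ S w) ≡⟨ cong (2 ^_) (∣tabulate∣≡count (λ w → adj G u w ∧ S w)) ⟨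
      2 ^ ∣ candidates u ∣              ∎
  ... | X , X⊆ , fresh = X , X⊆ , ≢⊥⇒Nonempty (fresh zero refl) , λ v → fresh (suc v)

  extend : ∀ u I → ValidLabelling I →
    ∃[ I′ ] (ValidLabelling I′ × (∀ v → Nonempty (I v) → Nonempty (I′ v)) × (S u ≡ false → Nonempty (I′ u)))
  extend u I valid with S u in Su | nonempty? (I u)
  ... | true  | _      = I , valid , (λ v ne → ne) , λ ()
  ... | false | yes ne = I , valid , (λ v ne → ne) , λ _ → ne
  ... | false | no  _  with fresh-label u I Su
  ...   | X , X⊆ , X-nonempty , fresh = I′ , valid′ , kept , λ _ → subst Nonempty (sym I′u≡X) X-nonempty
    where
    I′ : Fin n → Subset n
    I′ = updateAt I u (λ _ → X)

    I′u≡X : I′ u ≡ X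
    I′u≡X = updateAt-updates u I

    I′-other : ∀ {v} → v ≢ u → I′ v ≡ I v
    I′-other {v} v≢u = updateAt-minimal v u I v≢u

    -- If I v were X, every w ∈ X would be a common neighbour of u and v.
    X-new : ∀ v → I v ≢ X
    X-new v Iv≡X = fresh v (shareNbr-intro u∼w (trans (Graph.sym G w v) v∼w)) (sym Iv≡X)
      where
      w = proj₁ X-nonempty
      w∈X = proj₂ X-nonempty
      u∼w : adj G u w ≡ true
      u∼w = ∧-conicalˡ _ _ (∈-candidatesIn G S (X⊆ w∈X))
      v∼w : adj G v w ≡ true
      v∼w = ∧-conicalˡ _ _ (∈-candidatesIn G S (proj₂ (⊆-candidates valid v (subst Nonempty (sym Iv≡X) X-nonempty))
                                                 (subst (w ∈_) (sym Iv≡X) w∈X)))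

    kept : ∀ v → Nonempty (I v) → Nonempty (I′ v)
    kept v ne with v ≟ u
    ... | yes refl = subst Nonempty (sym I′u≡X) X-nonempty
    ... | no  v≢u  = subst Nonempty (sym (I′-other v≢u)) ne

    valid′ : ValidLabelling I′
    valid′ .⊆-candidates v ne with v ≟ u
    ... | yes refl = Su , subst (_⊆ candidates u) (sym I′u≡X) X⊆
    ... | no  v≢u  rewrite I′-other v≢u = ⊆-candidates valid v ne
    valid′ .distinct v₁ v₂ v₁≢v₂ ne with v₁ ≟ u | v₂ ≟ u
    ... | yes refl | yes refl = ⊥-elim (v₁≢v₂ refl)
    ... | yes refl | no  v₂≢u rewrite I′u≡X | I′-other v₂≢u = λ X≡Iv₂ → X-new v₂ (sym X≡Iv₂)
    ... | no  v₁≢u | yes refl rewrite I′u≡X | I′-other v₁≢u = X-new v₁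
    ... | no  v₁≢u | no  v₂≢u rewrite I′-other v₁≢u | I′-other v₂≢u = distinct valid v₁ v₂ v₁≢v₂ ne

  labelAll : ∀ (vs : List (Fin n)) → ∃[ I ] (ValidLabelling I × (∀ v → v ∈ₗ vs → S v ≡ false → Nonempty (I v)))
  labelAll []       = (λ _ → ⊥) , valid-⊥ , λ v ()
  labelAll (u ∷ vs) with labelAll vs
  ... | I , valid , labelled with extend u I valid
  ...   | I′ , valid′ , kept , new = I′ , valid′ , λ where
            v (here refl)    Sv → new Sv
            v (there v∈vs) Sv → kept v (labelled v v∈vs Sv)

  locatingDominating : ∃[ D ] IsLocDom D (tabulate S)
  locatingDominating = orientation , dominating , locating
    where
    labelling : ∃[ I ] (ValidLabelling I × (∀ v → v ∈ₗ allFin n → S v ≡ false → Nonempty (I v)))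
    labelling = labelAll (allFin n)
    I : Fin n → Subset n
    I = proj₁ labelling
    valid : ValidLabelling I
    valid = proj₁ (proj₂ labelling)
    open LabelOrientation G S I

    labelled : ∀ u → S u ≡ false → Nonempty (I u)
    labelled u = proj₂ (proj₂ labelling) u (∈-allFin u)

    S-false : ∀ {u} → lookup (tabulate S) u ≡ false → S u ≡ false
    S-false {u} = trans (sym (lookup∘tabulate S u))

    inNbrs≡I : ∀ u → S u ≡ false → inNbrsIn orientation (tabulate S) u ≡ I u
    inNbrs≡I u Su = inNbrsIn-orientation u Su (proj₂ (⊆-candidates valid u (labelled u Su)))

    dominating : ∀ u → lookup (tabulate S) u ≡ false → ∣ inNbrsIn orientation (tabulate S) u ∣ ≢ 0
    dominating u u∉S rewrite inNbrs≡I u (S-false u∉S) with labelled u (S-false u∉S)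
    ... | x , x∈Iu = λ ∣Iu∣≡0 → n≮0 (subst (∣ I u Subset.- x ∣ <_) ∣Iu∣≡0 (x∈p⇒∣p-x∣<∣p∣ x∈Iu))

    locating : ∀ u v → u ≢ v → lookup (tabulate S) u ≡ false → lookup (tabulate S) v ≡ false →
               inNbrsIn orientation (tabulate S) u ≢ inNbrsIn orientation (tabulate S) v
    locating u v u≢v u∉S v∉S rewrite inNbrs≡I u (S-false u∉S) | inNbrs≡I v (S-false v∉S) =
      distinct valid u v u≢v (labelled u (S-false u∉S))

budget : ∀ ℓ k → 1 ≤ ℓ → 1 ≤ k → 9 * (2 + (suc ℓ * k + suc ℓ * k) + suc ℓ) + 1 ≤ 73 * (ℓ * k)
budget (suc b) (suc a) _ _ =
  ≤-trans (m≤m+n _ (55 * (b * a) + 37 * a + 46 * b)) (≤-reflexive (sym (compare-coefficients a b)))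
  where
  compare-coefficients : ∀ a b → 73 * (suc b * suc a) ≡
    9 * (2 + (suc (suc b) * suc a + suc (suc b) * suc a) + suc (suc b)) + 1 + (55 * (b * a) + 37 * a + 46 * b)
  compare-coefficients = solve-∀

locatingDominatingSet-log : ∀ {n′} k (G : Graph (suc n′)) ℓ → 1 ≤ k → 1 ≤ ℓ → maxDeg G ≤ minDeg G ^ k →
  2 ^ ℓ ≤ minDeg G → minDeg G ≤ 2 ^ suc ℓ →
  ∃[ D ] ∃[ S ] (IsLocDom D S × 2 ^ (∣ S ∣ * minDeg G) ≤ minDeg G ^ (73 * k * suc n′))
locatingDominatingSet-log {n′} k G ℓ 1≤k 1≤ℓ Δ≤δ^k 2^ℓ≤δ δ≤2^[1+ℓ] =
  let S , size , dominated = multipleDominatingSet G m (suc ℓ) 1≤δ δ≤2^[1+ℓ]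
      D , locDom           = Labelling.locatingDominating G S m (maxDeg G) dominated (deg≤maxDeg G) 1+Δ²<2^m
  in  D , tabulate S , locDom , 2^-≤-^ {ℓ = ℓ} {N = 73 * k * n} (exponent S size) 2^ℓ≤δ
  where
  open ≤-Reasoning
  n δ e m : ℕ
  n = suc n′
  δ = minDeg G
  e = suc ℓ * k
  m = 2 + (e + e)

  1≤δ : 1 ≤ δ
  1≤δ = ≤-trans (m^n>0 2 ℓ) 2^ℓ≤δ

  Δ≤2^e : maxDeg G ≤ 2 ^ e
  Δ≤2^e = begin
    maxDeg G        ≤⟨ Δ≤δ^k ⟩
    δ ^ k           ≤⟨ ^-monoˡ-≤ k δ≤2^[1+ℓ] ⟩
    (2 ^ suc ℓ) ^ k ≡⟨ ^-*-assoc 2 (suc ℓ) k ⟩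
    2 ^ e           ∎

  1+Δ²<2^m : suc (maxDeg G * maxDeg G) < 2 ^ m
  1+Δ²<2^m = 1+x<2^[2+j] (e + e)
    (≤-trans (*-mono-≤ Δ≤2^e Δ≤2^e) (≤-reflexive (sym (^-distribˡ-+-* 2 e e))))

  exponent : ∀ S → count S * δ ≤ n * (9 * (m + suc ℓ) + 1) → ∣ tabulate S ∣ * δ ≤ ℓ * (73 * k * n)
  exponent S size = begin
    ∣ tabulate S ∣ * δ          ≡⟨ cong (_* δ) (∣tabulate∣≡count S) ⟩
    count S * δ                 ≤⟨ size ⟩
    n * (9 * (m + suc ℓ) + 1)   ≤⟨ *-monoʳ-≤ n (budget ℓ k 1≤ℓ 1≤k) ⟩
    n * (73 * (ℓ * k))          ≡⟨ regroup n ℓ k ⟩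
    ℓ * (73 * k * n)            ∎
    where
    regroup : ∀ n ℓ k → n * (73 * (ℓ * k)) ≡ ℓ * (73 * k * n)
    regroup = solve-∀

locatingDominatingSet : ∀ {n′} k (G : Graph (suc n′)) → 1 ≤ k → maxDeg G ≤ minDeg G ^ k → 2 ≤ minDeg G →
  ∃[ D ] ∃[ S ] (IsLocDom D S × 2 ^ (∣ S ∣ * minDeg G) ≤ minDeg G ^ (73 * k * suc n′))
locatingDominatingSet k G 1≤k Δ≤δ^k 2≤δ with log₂-bracket (minDeg G) (≤-trans (s≤s z≤n) 2≤δ)
... | zero  , _     , δ<2       = ⊥-elim (<⇒≱ δ<2 2≤δ)
... | suc ℓ , 2^ℓ≤δ , δ<2^[1+ℓ] =
  locatingDominatingSet-log k G (suc ℓ) 1≤k (s≤s z≤n) Δ≤δ^k 2^ℓ≤δ (<⇒≤ δ<2^[1+ℓ])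

theorem22 : (k : ℕ) → k ≥ 1 →
    (𝒢 : (n : ℕ) → Graph n → Set) →
    (∀ n (G : Graph n) → 𝒢 n G → maxDeg G ≤ minDeg G ^ k) →
    ∃[ c ] (∀ n (G : Graph n) → 𝒢 n G → 2 ≤ minDeg G →
      ∃[ D ] ∃[ S ] (IsLocDom {n} {G} D S ×
        2 ^ (∣ S ∣ * minDeg G) ≤ minDeg G ^ (c * n)))
theorem22 k 1≤k 𝒢 Δ≤δ^k = 73 * k , λ where
  zero     G _   ()
  (suc n′) G G∈𝒢 2≤δ → locatingDominatingSet k G 1≤k (Δ≤δ^k _ G G∈𝒢) 2≤δ
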